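{- Let $\mathcal{F}$ be a set of graphs such that for every $F\in\{2K_2,C_4,P_4\}$, $\mathcal{F}$ contains a graph isomorphic to an induced subgraph of $F$. Then $\mathcal{F}$ is dominance monotone.
   Context: All graphs are finite and simple; $K_n,C_n,P_n$ are the complete graph, cycle and path on $n$ vertices, and $aG$ is the disjoint union of $a$ copies of $G$. For lists $d=(d_1,\dots,d_n)$ and $e=(e_1,\dots,e_p)$ of positive integers in nonincreasing order, $d\succeq e$ if $\sum d_i=\sum e_i$ and $\sum_{i=1}^k e_i\le\sum_{i=1}^k d_i$ for $1\le k\le\min\{p,n\}$. A graph is $\mathcal{F}$-free if no induced subgraph is isomorphic to an element of $\mathcal{F}$; a degree sequence is forcibly $\mathcal{F}$-free if every realization (graph with that degree sequence) is $\mathcal{F}$-free. $\mathcal{F}$ is dominance monotone if whenever $d,e$ are degree sequences with positive terms, $d\succeq e$, and $e$ is forcibly $\mathcal{F}$-free, then $d$ is forcibly $\mathcal{F}$-free. -}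

module Defs where

open import Data.Nat using (ℕ; zero; suc; _+_; _≤_; _<_; _≥_; _⊓_)
open import Data.Bool using (Bool; true; false; if_then_else_; _∨_)
open import Data.Bool.Properties using (∨-comm)
open import Data.Fin using (Fin; toℕ)
open import Data.Fin.Patterns using (0F; 1F; 2F; 3F)
open import Data.List using (List; []; _∷_; length; map; take; allFin)
open import Data.Nat.ListAction using (sum)
open import Data.List.Relation.Unary.All using (All)
open import Data.List.Relation.Unary.Linked using (Linked)
open import Data.List.Relation.Binary.Permutation.Propositional using (_↭_)
open import Data.Product using (Σ; ∃; _×_; _,_)
open import Relation.Binary.PropositionalEquality using (_≡_; refl)
open import Relation.Nullary using (¬_)
open import Function.Definitions using (Injective)

record Graph (n : ℕ) : Set where
  field
    adj     : Fin n → Fin n → Bool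
    adj-sym : ∀ i j → adj i j ≡ adj j i
    irrefl  : ∀ i → adj i i ≡ false
open Graph public

degree : ∀ {n} → Graph n → Fin n → ℕ
degree {n} G i = sum (map (λ j → if adj G i j then 1 else 0) (allFin n))

degrees : ∀ {n} → Graph n → List ℕ
degrees {n} G = map (degree G) (allFin n)

_≼ᵢ_ : ∀ {m n} → Graph m → Graph n → Set
_≼ᵢ_ {m} {n} H G =
  Σ (Fin m → Fin n) λ f → Injective _≡_ _≡_ f × (∀ i j → adj H i j ≡ adj G (f i) (f j))

Family : Set₁
Family = (m : ℕ) → Graph m → Set

Free : Family → ∀ {n} → Graph n → Set
Free ℱ G = ∀ m (H : Graph m) → ℱ m H → ¬ (H ≼ᵢ G)

Realizes : ∀ (d : List ℕ) → Graph (length d) → Set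
Realizes d G = degrees G ↭ d

IsPosDegSeq : List ℕ → Set
IsPosDegSeq d = Linked _≥_ d × All (λ x → 0 < x) d × ∃ (λ (G : Graph (length d)) → Realizes d G)

ForciblyFree : Family → List ℕ → Set
ForciblyFree ℱ d = ∀ (G : Graph (length d)) → Realizes d G → Free ℱ G

_⪰_ : List ℕ → List ℕ → Set
d ⪰ e = sum d ≡ sum e
      × (∀ k → 1 ≤ k → k ≤ length e ⊓ length d → sum (take k e) ≤ sum (take k d))

DominanceMonotone : Family → Set
DominanceMonotone ℱ = ∀ d e → IsPosDegSeq d → IsPosDegSeq e → d ⪰ e →
  ForciblyFree ℱ e → ForciblyFree ℱ d

fromEdges4 : (e : ℕ → ℕ → Bool) → (∀ (i : Fin 4) → e (toℕ i) (toℕ i) ≡ false) → Graph 4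
fromEdges4 e irr = record
  { adj = λ i j → e (toℕ i) (toℕ j) ∨ e (toℕ j) (toℕ i)
  ; adj-sym = λ i j → ∨-comm (e (toℕ i) (toℕ j)) (e (toℕ j) (toℕ i))
  ; irrefl = λ i → irr2 i }
  where
  irr2 : ∀ (i : Fin 4) → e (toℕ i) (toℕ i) ∨ e (toℕ i) (toℕ i) ≡ false
  irr2 i with e (toℕ i) (toℕ i) | irr i
  ... | false | _ = refl

-- edge tests (one orientation each; symmetrized by fromEdges4)
e2K2 : ℕ → ℕ → Bool
e2K2 0 1 = true
e2K2 2 3 = true
e2K2 _ _ = false

eC4 : ℕ → ℕ → Bool
eC4 0 1 = true
eC4 1 2 = true
eC4 2 3 = true
eC4 3 0 = true
eC4 _ _ = false

eP4 : ℕ → ℕ → Bool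
eP4 0 1 = true
eP4 1 2 = true
eP4 2 3 = true
eP4 _ _ = false

twoK2 : Graph 4
twoK2 = fromEdges4 e2K2 λ { 0F → refl ; 1F → refl ; 2F → refl ; 3F → refl }

C4 : Graph 4
C4 = fromEdges4 eC4 λ { 0F → refl ; 1F → refl ; 2F → refl ; 3F → refl }

P4 : Graph 4
P4 = fromEdges4 eP4 λ { 0F → refl ; 1F → refl ; 2F → refl ; 3F → refl }

ContainsInducedSubOf : Family → ∀ {n} → Graph n → Set
ContainsInducedSubOf ℱ F = ∃ λ m → ∃ λ (H : Graph m) → ℱ m H × (H ≼ᵢ F)

-- A realization G of e is {2K₂, C₄, P₄}-free, i.e. a threshold graph, so its neighbourhoods are
-- nested. Hence a vertex of maximum degree is either dominating or has a non-neighbour, which is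
-- then isolated. Removing such a vertex shows by induction that the degree sequence of a threshold
-- graph is maximal under majorization among degree sequences of graphs of the same order: if d ⪰ e
-- and e starts with n - 1 (ends with 0), then so does d, so a realization of d also has a dominating
-- (isolated) vertex, and deleting both vertices preserves majorization. Positivity of the terms forces
-- d and e to have equal length, so d = e.

module Submission where

open import Defs
open import Data.Bool using (Bool; true; false; if_then_else_)
open import Data.Bool.Properties using () renaming (_≟_ to _≟ᵇ_)
open import Data.Empty using (⊥; ⊥-elim)
open import Data.Fin using (Fin; zero; suc; punchIn; punchOut)
open import Data.Fin.Patterns using (0F; 1F; 2F; 3F)
open import Data.Fin.Properties
  using (punchInᵢ≢i; punchIn-punchOut; punchIn-injective; any?) renaming (_≟_ to _≟ᶠ_)
open import Data.List
  using (List; []; _∷_; _++_; [_]; _∷ʳ_; length; map; take; allFin; tabulate; initLast; _∷ʳ′_)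
open import Data.List.Properties
  using (map-id; map-∘; length-++; map-tabulate; tabulate-cong; length-tabulate; take-map; length-take; take-all)
open import Data.List.Extrema.Nat using (argmax; f[xs]≤f[argmax])
open import Data.List.Membership.Propositional using (_∈_)
open import Data.List.Membership.Propositional.Properties using (∈-allFin; ∈-map⁻; ∈-++⁺ʳ)
open import Data.List.Relation.Binary.Permutation.Propositional
  using (_↭_; prep; swap; ↭-refl; ↭-trans; ↭-sym; ↭-reflexive; module PermutationReasoning)
open import Data.List.Relation.Binary.Permutation.Propositional.Properties
  using (drop-∷; ∈-resp-↭; All-resp-↭; ↭-length; ++-comm; ↭-empty-inv; ¬x∷xs↭[]) renaming (map⁺ to ↭-map⁺)
open import Data.List.Relation.Unary.All as All using (All; []; _∷_)
import Data.List.Relation.Unary.All.Properties as All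
open import Data.List.Relation.Unary.Any using (here; there)
open import Data.List.Relation.Unary.Linked as Linked using (Linked; []; [-]; _∷_)
open import Data.List.Relation.Unary.Linked.Properties using (Linked⇒All) renaming (map⁻ to Linked-map⁻)
open import Data.Nat using (ℕ; zero; suc; pred; _+_; _≤_; _<_; _≥_; _⊓_; z≤n; s≤s; s≤s⁻¹; _≤?_)
open import Data.Nat.ListAction using (sum)
open import Data.Nat.ListAction.Properties using (sum-↭; sum-++)
open import Data.Nat.Properties
open import Data.Product using (∃; _×_; _,_; proj₁)
open import Data.Sum as Sum using (_⊎_; inj₁; inj₂)
open import Function using (_∘_; id)
open import Algebra.Properties.CommutativeSemigroup +-commutativeSemigroup using (interchange; x∙yz≈y∙xz)
open import Relation.Binary.PropositionalEquality hiding ([_])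
open import Relation.Nullary using (¬_; Dec; yes; no; does; contradiction; ¬?; _×-dec_)

𝟙 : Bool → ℕ
𝟙 b = if b then 1 else 0

𝟙≤1 : ∀ b → 𝟙 b ≤ 1
𝟙≤1 true  = ≤-refl
𝟙≤1 false = z≤n

∑ : ∀ {n} → (Fin n → ℕ) → ℕ
∑ f = sum (tabulate f)

tabulate-↭-punchIn : ∀ {n} {A : Set} (f : Fin (suc n) → A) v →
                     tabulate f ↭ f v ∷ tabulate (f ∘ punchIn v)
tabulate-↭-punchIn f zero = ↭-refl
tabulate-↭-punchIn {suc n} f (suc v) =
  ↭-trans (prep (f zero) (tabulate-↭-punchIn (f ∘ suc) v)) (swap (f zero) (f (suc v)) ↭-refl)

∑-punchIn : ∀ {n} (f : Fin (suc n) → ℕ) v → ∑ f ≡ f v + ∑ (f ∘ punchIn v)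
∑-punchIn f v = sum-↭ (tabulate-↭-punchIn f v)

∑-mono-≤ : ∀ {n} {f g : Fin n → ℕ} → (∀ i → f i ≤ g i) → ∑ f ≤ ∑ g
∑-mono-≤ {zero}  f≤g = z≤n
∑-mono-≤ {suc n} f≤g = +-mono-≤ (f≤g zero) (∑-mono-≤ (f≤g ∘ suc))

∑-mono-< : ∀ {n} {f g : Fin n → ℕ} → (∀ i → f i ≤ g i) → ∀ i → f i < g i → ∑ f < ∑ g
∑-mono-< {suc n} {f} {g} f≤g i fi<gi
  rewrite ∑-punchIn f i | ∑-punchIn g i = +-mono-<-≤ fi<gi (∑-mono-≤ (f≤g ∘ punchIn i))

∑-+ : ∀ {n} (f g : Fin n → ℕ) → ∑ (λ i → f i + g i) ≡ ∑ f + ∑ g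
∑-+ {zero}  f g = refl
∑-+ {suc n} f g rewrite ∑-+ (f ∘ suc) (g ∘ suc) = interchange (f zero) (g zero) _ _

∑-zero : ∀ {n} {f : Fin n → ℕ} → (∀ i → f i ≡ 0) → ∑ f ≡ 0
∑-zero {zero}  f≡0 = refl
∑-zero {suc n} f≡0 rewrite f≡0 zero = ∑-zero (f≡0 ∘ suc)

∑-one : ∀ n → ∑ {n} (λ _ → 1) ≡ n
∑-one zero    = refl
∑-one (suc n) = cong suc (∑-one n)

term≤∑ : ∀ {n} (f : Fin n → ℕ) i → f i ≤ ∑ f
term≤∑ {suc n} f i rewrite ∑-punchIn f i = m≤m+n (f i) _

pointAt : ∀ {n} → Fin n → ℕ → Fin n → ℕ
pointAt w a j = if does (j ≟ᶠ w) then a else 0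

pointAt-same : ∀ {n} (w : Fin n) a → pointAt w a w ≡ a
pointAt-same w a with w ≟ᶠ w
... | yes _   = refl
... | no w≢w = contradiction refl w≢w

pointAt-other : ∀ {n} {j w : Fin n} a → j ≢ w → pointAt w a j ≡ 0
pointAt-other {j = j} {w} a j≢w with j ≟ᶠ w
... | yes j≡w = contradiction j≡w j≢w
... | no _    = refl

∑-pointAt : ∀ {n} (w : Fin n) a → ∑ (pointAt w a) ≡ a
∑-pointAt {suc n} w a = begin
  ∑ (pointAt w a)                                 ≡⟨ ∑-punchIn (pointAt w a) w ⟩
  pointAt w a w + ∑ (pointAt w a ∘ punchIn w)     ≡⟨ cong₂ _+_ (pointAt-same w a) (∑-zero (pointAt-other a ∘ punchInᵢ≢i w)) ⟩
  a + 0                                           ≡⟨ +-identityʳ a ⟩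
  a                                               ∎
  where open ≡-Reasoning

degree-∑ : ∀ {n} (G : Graph n) i → degree G i ≡ ∑ (𝟙 ∘ adj G i)
degree-∑ G i = cong sum (map-tabulate id (𝟙 ∘ adj G i))

degrees-tabulate : ∀ {n} (G : Graph n) → degrees G ≡ tabulate (degree G)
degrees-tabulate G = map-tabulate id (degree G)

length-degrees : ∀ {n} (G : Graph n) → length (degrees G) ≡ n
length-degrees G = trans (cong length (degrees-tabulate G)) (length-tabulate (degree G))

∈-degrees⁻ : ∀ {n} (G : Graph n) {y} → y ∈ degrees G → ∃ λ u → degree G u ≡ y
∈-degrees⁻ G y∈ with ∈-map⁻ (degree G) y∈
... | u , _ , y≡ = u , sym y≡

Dominating : ∀ {n} → Graph n → Fin n → Set
Dominating G v = ∀ j → j ≢ v → adj G v j ≡ true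

Isolated : ∀ {n} → Graph n → Fin n → Set
Isolated G v = ∀ j → adj G v j ≡ false

adj⇒≢ : ∀ {n} (G : Graph n) {i j} → adj G i j ≡ true → j ≢ i
adj⇒≢ G {i} ij refl with () ← trans (sym ij) (irrefl G i)

degree-others : ∀ {n} (G : Graph (suc n)) v → degree G v ≡ ∑ (𝟙 ∘ adj G v ∘ punchIn v)
degree-others G v = begin
  degree G v                                           ≡⟨ degree-∑ G v ⟩
  ∑ (𝟙 ∘ adj G v)                                      ≡⟨ ∑-punchIn (𝟙 ∘ adj G v) v ⟩
  𝟙 (adj G v v) + ∑ (𝟙 ∘ adj G v ∘ punchIn v)           ≡⟨ cong (λ b → 𝟙 b + ∑ (𝟙 ∘ adj G v ∘ punchIn v)) (irrefl G v) ⟩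
  ∑ (𝟙 ∘ adj G v ∘ punchIn v)                          ∎
  where open ≡-Reasoning

degree≤ : ∀ {n} (G : Graph (suc n)) v → degree G v ≤ n
degree≤ {n} G v = begin
  degree G v                   ≡⟨ degree-others G v ⟩
  ∑ (𝟙 ∘ adj G v ∘ punchIn v)  ≤⟨ ∑-mono-≤ (λ i → 𝟙≤1 (adj G v (punchIn v i))) ⟩
  ∑ {n} (λ _ → 1)              ≡⟨ ∑-one n ⟩
  n                            ∎
  where open ≤-Reasoning

degree≡n⇒Dominating : ∀ {n} (G : Graph (suc n)) v → degree G v ≡ n → Dominating G v
degree≡n⇒Dominating {n} G v deg≡n j j≢v with adj G v j in vj
... | true  = refl
... | false = ⊥-elim (<-irrefl deg≡n (begin-strict
  degree G v                   ≡⟨ degree-others G v ⟩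
  ∑ (𝟙 ∘ adj G v ∘ punchIn v)  <⟨ ∑-mono-< (λ i → 𝟙≤1 (adj G v (punchIn v i))) i
                                             (subst (λ b → 𝟙 b < 1) (sym vj′) (s≤s z≤n)) ⟩
  ∑ {n} (λ _ → 1)              ≡⟨ ∑-one n ⟩
  n                            ∎))
  where
  open ≤-Reasoning
  i : Fin n
  i = punchOut (j≢v ∘ sym)
  vj′ : adj G v (punchIn v i) ≡ false
  vj′ = trans (cong (adj G v) (punchIn-punchOut (j≢v ∘ sym))) vj

Dominating⇒degree≡n : ∀ {n} (G : Graph (suc n)) v → Dominating G v → degree G v ≡ n
Dominating⇒degree≡n {n} G v dom = begin
  degree G v                   ≡⟨ degree-others G v ⟩
  ∑ (𝟙 ∘ adj G v ∘ punchIn v)  ≡⟨ cong sum (tabulate-cong (λ i → cong 𝟙 (dom _ (punchInᵢ≢i v i)))) ⟩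
  ∑ {n} (λ _ → 1)              ≡⟨ ∑-one n ⟩
  n                            ∎
  where open ≡-Reasoning

degree≡0⇒Isolated : ∀ {n} (G : Graph n) v → degree G v ≡ 0 → Isolated G v
degree≡0⇒Isolated G v deg≡0 j with adj G v j in vj
... | false = refl
... | true  = contradiction (subst₂ _≤_ (cong 𝟙 vj) (trans (sym (degree-∑ G v)) deg≡0) (term≤∑ (𝟙 ∘ adj G v) j)) λ ()

Isolated⇒degree≡0 : ∀ {n} (G : Graph n) v → Isolated G v → degree G v ≡ 0
Isolated⇒degree≡0 G v iso = trans (degree-∑ G v) (∑-zero (cong 𝟙 ∘ iso))

_─_ : ∀ {n} → Graph (suc n) → Fin (suc n) → Graph n
G ─ v = record
  { adj     = λ i j → adj G (punchIn v i) (punchIn v j)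
  ; adj-sym = λ i j → adj-sym G (punchIn v i) (punchIn v j)
  ; irrefl  = λ i → irrefl G (punchIn v i)
  }

─-≼ᵢ : ∀ {n} (G : Graph (suc n)) v → (G ─ v) ≼ᵢ G
─-≼ᵢ G v = punchIn v , punchIn-injective v _ _ , λ i j → refl

degree-punchIn : ∀ {n} (G : Graph (suc n)) v i →
                 degree G (punchIn v i) ≡ 𝟙 (adj G v (punchIn v i)) + degree (G ─ v) i
degree-punchIn G v i = begin
  degree G (punchIn v i)                                          ≡⟨ degree-∑ G (punchIn v i) ⟩
  ∑ (𝟙 ∘ adj G (punchIn v i))                                     ≡⟨ ∑-punchIn (𝟙 ∘ adj G (punchIn v i)) v ⟩
  𝟙 (adj G (punchIn v i) v) + ∑ (𝟙 ∘ adj G (punchIn v i) ∘ punchIn v)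
    ≡⟨ cong₂ _+_ (cong 𝟙 (adj-sym G _ v)) (sym (degree-∑ (G ─ v) i)) ⟩
  𝟙 (adj G v (punchIn v i)) + degree (G ─ v) i                   ∎
  where open ≡-Reasoning

degrees-delete : ∀ {n} (G : Graph (suc n)) v c → (∀ i → 𝟙 (adj G v (punchIn v i)) ≡ c) →
                 degrees G ↭ degree G v ∷ map (c +_) (degrees (G ─ v))
degrees-delete G v c uniform = begin
  degrees G                                               ≡⟨ degrees-tabulate G ⟩
  tabulate (degree G)                                     ↭⟨ tabulate-↭-punchIn (degree G) v ⟩
  degree G v ∷ tabulate (degree G ∘ punchIn v)
    ≡⟨ cong (degree G v ∷_) (tabulate-cong λ i → trans (degree-punchIn G v i) (cong (_+ _) (uniform i))) ⟩
  degree G v ∷ tabulate ((c +_) ∘ degree (G ─ v))         ≡⟨ cong (degree G v ∷_) (sym (map-tabulate (degree (G ─ v)) (c +_))) ⟩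
  degree G v ∷ map (c +_) (tabulate (degree (G ─ v)))
    ≡⟨ cong (λ ds → degree G v ∷ map (c +_) ds) (sym (degrees-tabulate (G ─ v))) ⟩
  degree G v ∷ map (c +_) (degrees (G ─ v))               ∎
  where open PermutationReasoning

degrees-delete-Dominating : ∀ {n} (G : Graph (suc n)) v → Dominating G v →
                            degrees G ↭ n ∷ map suc (degrees (G ─ v))
degrees-delete-Dominating G v dom =
  ↭-trans (degrees-delete G v 1 (λ i → cong 𝟙 (dom _ (punchInᵢ≢i v i))))
          (↭-reflexive (cong (_∷ map suc (degrees (G ─ v))) (Dominating⇒degree≡n G v dom)))

degrees-delete-Isolated : ∀ {n} (G : Graph (suc n)) v → Isolated G v →
                          degrees G ↭ 0 ∷ degrees (G ─ v)
degrees-delete-Isolated G v iso =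
  ↭-trans (degrees-delete G v 0 (λ i → cong 𝟙 (iso (punchIn v i))))
          (↭-reflexive (cong₂ _∷_ (Isolated⇒degree≡0 G v iso) (map-id (degrees (G ─ v)))))

≼ᵢ-trans : ∀ {a b c} {A : Graph a} {B : Graph b} {C : Graph c} → A ≼ᵢ B → B ≼ᵢ C → A ≼ᵢ C
≼ᵢ-trans (f , f-inj , f-adj) (g , g-inj , g-adj) =
  g ∘ f , f-inj ∘ g-inj , λ i j → trans (f-adj i j) (g-adj (f i) (f j))

Free⇒¬≼ᵢ : ∀ {ℱ m n} {F : Graph m} {G : Graph n} → ContainsInducedSubOf ℱ F → Free ℱ G → ¬ F ≼ᵢ G
Free⇒¬≼ᵢ {F = F} {G} (_ , H , H∈ℱ , H≼F) G-free F≼G = G-free _ H H∈ℱ (≼ᵢ-trans {A = H} {B = F} {C = G} H≼F F≼G)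

-- By Chvátal and Hammer, these are exactly the threshold graphs.
record Threshold {n} (G : Graph n) : Set where
  constructor threshold
  field
    no-2K₂ : ¬ twoK2 ≼ᵢ G
    no-C₄  : ¬ C4 ≼ᵢ G
    no-P₄  : ¬ P4 ≼ᵢ G

Threshold-≼ᵢ : ∀ {m n} {H : Graph m} {G : Graph n} → H ≼ᵢ G → Threshold G → Threshold H
Threshold-≼ᵢ {H = H} {G} H≼G (threshold no-2K₂ no-C₄ no-P₄) = threshold
  (no-2K₂ ∘ λ F≼H → ≼ᵢ-trans {A = twoK2} {B = H} {C = G} F≼H H≼G)
  (no-C₄ ∘ λ F≼H → ≼ᵢ-trans {A = C4} {B = H} {C = G} F≼H H≼G)
  (no-P₄ ∘ λ F≼H → ≼ᵢ-trans {A = P4} {B = H} {C = G} F≼H H≼G)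

embed₄ : ∀ {n} (F : Graph 4) (G : Graph n) (a₀ a₁ a₂ a₃ : Fin n) →
         a₀ ≢ a₁ → a₀ ≢ a₂ → a₀ ≢ a₃ → a₁ ≢ a₂ → a₁ ≢ a₃ → a₂ ≢ a₃ →
         adj F 0F 1F ≡ adj G a₀ a₁ → adj F 0F 2F ≡ adj G a₀ a₂ → adj F 0F 3F ≡ adj G a₀ a₃ →
         adj F 1F 2F ≡ adj G a₁ a₂ → adj F 1F 3F ≡ adj G a₁ a₃ → adj F 2F 3F ≡ adj G a₂ a₃ →
         F ≼ᵢ G
embed₄ {n} F G a₀ a₁ a₂ a₃ a₀₁ a₀₂ a₀₃ a₁₂ a₁₃ a₂₃ e₀₁ e₀₂ e₀₃ e₁₂ e₁₃ e₂₃ = f , f-inj , f-adj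
  where
  f : Fin 4 → Fin n
  f 0F = a₀
  f 1F = a₁
  f 2F = a₂
  f 3F = a₃
  f-inj : ∀ {i j} → f i ≡ f j → i ≡ j
  f-inj {0F} {0F} _ = refl
  f-inj {1F} {1F} _ = refl
  f-inj {2F} {2F} _ = refl
  f-inj {3F} {3F} _ = refl
  f-inj {0F} {1F} e = contradiction e a₀₁
  f-inj {0F} {2F} e = contradiction e a₀₂
  f-inj {0F} {3F} e = contradiction e a₀₃
  f-inj {1F} {2F} e = contradiction e a₁₂
  f-inj {1F} {3F} e = contradiction e a₁₃
  f-inj {2F} {3F} e = contradiction e a₂₃
  f-inj {1F} {0F} e = contradiction (sym e) a₀₁
  f-inj {2F} {0F} e = contradiction (sym e) a₀₂
  f-inj {3F} {0F} e = contradiction (sym e) a₀₃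
  f-inj {2F} {1F} e = contradiction (sym e) a₁₂
  f-inj {3F} {1F} e = contradiction (sym e) a₁₃
  f-inj {3F} {2F} e = contradiction (sym e) a₂₃
  flip : ∀ i j → adj F i j ≡ adj G (f i) (f j) → adj F j i ≡ adj G (f j) (f i)
  flip i j e = trans (adj-sym F j i) (trans e (adj-sym G (f i) (f j)))
  diagonal : ∀ i → adj F i i ≡ adj G (f i) (f i)
  diagonal i = trans (irrefl F i) (sym (irrefl G (f i)))
  f-adj : ∀ i j → adj F i j ≡ adj G (f i) (f j)
  f-adj 0F 1F = e₀₁
  f-adj 0F 2F = e₀₂
  f-adj 0F 3F = e₀₃
  f-adj 1F 2F = e₁₂
  f-adj 1F 3F = e₁₃
  f-adj 2F 3F = e₂₃
  f-adj 1F 0F = flip 0F 1F e₀₁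
  f-adj 2F 0F = flip 0F 2F e₀₂
  f-adj 3F 0F = flip 0F 3F e₀₃
  f-adj 2F 1F = flip 1F 2F e₁₂
  f-adj 3F 1F = flip 1F 3F e₁₃
  f-adj 3F 2F = flip 2F 3F e₂₃
  f-adj 0F 0F = diagonal 0F
  f-adj 1F 1F = diagonal 1F
  f-adj 2F 2F = diagonal 2F
  f-adj 3F 3F = diagonal 3F

Threshold⇒¬alternating-cycle : ∀ {n} {G : Graph n} → Threshold G → ∀ {v w y z} →
  w ≢ v → y ≢ w → z ≢ v →
  adj G v y ≡ true → adj G w z ≡ true → adj G v z ≡ false → adj G w y ≡ false → ⊥
Threshold⇒¬alternating-cycle {G = G} (threshold no-2K₂ no-C₄ no-P₄) {v} {w} {y} {z} w≢v y≢w z≢v vy wz vz wy =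
  by-cases (adj G v w) (adj G y z) refl refl
  where
  v≢y : v ≢ y
  v≢y = adj⇒≢ G vy ∘ sym
  w≢z : w ≢ z
  w≢z = adj⇒≢ G wz ∘ sym
  y≢z : y ≢ z
  y≢z refl with () ← trans (sym vy) vz
  yv : adj G y v ≡ true
  yv = trans (adj-sym G y v) vy
  yw : adj G y w ≡ false
  yw = trans (adj-sym G y w) wy
  zw : adj G z w ≡ true
  zw = trans (adj-sym G z w) wz
  by-cases : ∀ b c → adj G v w ≡ b → adj G y z ≡ c → ⊥
  by-cases false false vw yz = no-2K₂ (embed₄ twoK2 G v y w z v≢y (w≢v ∘ sym) (z≢v ∘ sym) y≢w y≢z w≢z
    (sym vy) (sym vw) (sym vz) (sym yw) (sym yz) (sym wz))
  by-cases true false vw yz = no-P₄ (embed₄ P4 G y v w z (v≢y ∘ sym) y≢w y≢z (w≢v ∘ sym) (z≢v ∘ sym) w≢z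
    (sym yv) (sym yw) (sym yz) (sym vw) (sym vz) (sym wz))
  by-cases false true vw yz = no-P₄ (embed₄ P4 G v y z w v≢y (z≢v ∘ sym) (w≢v ∘ sym) y≢z y≢w (w≢z ∘ sym)
    (sym vy) (sym vz) (sym vw) (sym yz) (sym yw) (sym zw))
  by-cases true true vw yz = no-C₄ (embed₄ C4 G v y z w v≢y (z≢v ∘ sym) (w≢v ∘ sym) y≢z y≢w (w≢z ∘ sym)
    (sym vy) (sym vz) (sym vw) (sym yz) (sym yw) (sym zw))

-- N x counts the neighbours of x and additionally a = [v ~ w] at x itself, so that N v and N w agree
-- on v and w and the comparison of degrees reduces to the comparison of neighbourhoods elsewhere.
nested-neighbourhoods⇒degree< : ∀ {n} (G : Graph n) {v w z} → w ≢ v → z ≢ v →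
  (∀ j → j ≢ w → adj G v j ≡ true → adj G w j ≡ true) →
  adj G w z ≡ true → adj G v z ≡ false → degree G v < degree G w
nested-neighbourhoods⇒degree< {n} G {v} {w} {z} w≢v z≢v nested wz vz =
  +-cancelʳ-< a (degree G v) (degree G w) (subst₂ _<_ (∑N v) (∑N w) (∑-mono-< N-mono z N-strict))
  where
  a : ℕ
  a = 𝟙 (adj G v w)
  N : Fin n → Fin n → ℕ
  N x j = 𝟙 (adj G x j) + pointAt x a j
  ∑N : ∀ x → ∑ (N x) ≡ degree G x + a
  ∑N x = trans (∑-+ (𝟙 ∘ adj G x) (pointAt x a)) (cong₂ _+_ (sym (degree-∑ G x)) (∑-pointAt x a))
  N-self : ∀ x → N x x ≡ a
  N-self x = cong₂ _+_ (cong 𝟙 (irrefl G x)) (pointAt-same x a)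
  N-other : ∀ {x y} → y ≢ x → adj G x y ≡ adj G v w → N x y ≡ a
  N-other y≢x xy = trans (cong₂ _+_ (cong 𝟙 xy) (pointAt-other a y≢x)) (+-identityʳ a)
  N-outside : ∀ x {j} → j ≢ x → N x j ≡ 𝟙 (adj G x j)
  N-outside x {j} j≢x = trans (cong (𝟙 (adj G x j) +_) (pointAt-other a j≢x)) (+-identityʳ _)
  neighbour-mono : ∀ j → j ≢ w → 𝟙 (adj G v j) ≤ 𝟙 (adj G w j)
  neighbour-mono j j≢w with adj G v j in vj
  ... | false = z≤n
  ... | true  = ≤-reflexive (cong 𝟙 (sym (nested j j≢w vj)))
  N-mono-cases : ∀ j → Dec (j ≡ v) → Dec (j ≡ w) → N v j ≤ N w j
  N-mono-cases j (yes refl) _          = ≤-reflexive (trans (N-self v) (sym (N-other (w≢v ∘ sym) (adj-sym G w v))))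
  N-mono-cases j (no _)     (yes refl) = ≤-reflexive (trans (N-other w≢v refl) (sym (N-self w)))
  N-mono-cases j (no j≢v)   (no j≢w)   =
    subst₂ _≤_ (sym (N-outside v j≢v)) (sym (N-outside w j≢w)) (neighbour-mono j j≢w)
  N-mono : ∀ j → N v j ≤ N w j
  N-mono j = N-mono-cases j (j ≟ᶠ v) (j ≟ᶠ w)
  N-strict : N v z < N w z
  N-strict = subst₂ _<_ (sym (trans (N-outside v z≢v) (cong 𝟙 vz)))
                        (cong (λ b → 𝟙 b + pointAt w a z) (sym wz)) (s≤s z≤n)

Threshold-maxDegree-adj : ∀ {n} {G : Graph n} → Threshold G → ∀ {v} → (∀ j → degree G j ≤ degree G v) →
                          ∀ {w z} → w ≢ v → z ≢ v → adj G w z ≡ true → adj G v z ≡ true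
Threshold-maxDegree-adj {G = G} thr {v} max {w} {z} w≢v z≢v wz with adj G v z in vz
... | true  = refl
... | false = contradiction (max w) (<⇒≱ (nested-neighbourhoods⇒degree< G w≢v z≢v nested wz vz))
  where
  nested : ∀ j → j ≢ w → adj G v j ≡ true → adj G w j ≡ true
  nested j j≢w vj with adj G w j in wj
  ... | true  = refl
  ... | false = ⊥-elim (Threshold⇒¬alternating-cycle thr w≢v j≢w z≢v vj wz vz wj)

maxDegree-vertex : ∀ {n} (G : Graph (suc n)) → ∃ λ v → ∀ j → degree G j ≤ degree G v
maxDegree-vertex {n} G =
  argmax (degree G) zero (allFin (suc n)) ,
  λ j → All.lookup (f[xs]≤f[argmax] {f = degree G} zero (allFin (suc n))) (∈-allFin j)

Dominating⊎nonNeighbour : ∀ {n} (G : Graph n) v → Dominating G v ⊎ ∃ λ b → b ≢ v × adj G v b ≡ false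
Dominating⊎nonNeighbour G v with any? (λ b → ¬? (b ≟ᶠ v) ×-dec (adj G v b ≟ᵇ false))
... | yes nonNeighbour = inj₂ nonNeighbour
... | no ¬nonNeighbour = inj₁ dominating
  where
  dominating : Dominating G v
  dominating j j≢v with adj G v j in vj
  ... | true  = refl
  ... | false = contradiction (j , j≢v , vj) ¬nonNeighbour

maxDegree⇒Dominating⊎Isolated : ∀ {n} {G : Graph n} → Threshold G → ∀ {v} → (∀ j → degree G j ≤ degree G v) →
                                Dominating G v ⊎ ∃ (Isolated G)
maxDegree⇒Dominating⊎Isolated {G = G} thr {v} max = Sum.map₂ non-neighbour-isolated (Dominating⊎nonNeighbour G v)
  where
  non-neighbour-isolated : (∃ λ b → b ≢ v × adj G v b ≡ false) → ∃ (Isolated G)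
  non-neighbour-isolated (b , b≢v , vb) = b , b-isolated
    where
    v-adj-b : ∀ {c} → adj G b c ≡ true → adj G v b ≡ true
    v-adj-b {c} bc = Threshold-maxDegree-adj thr max (adj⇒≢ G vc) b≢v (trans (adj-sym G c b) bc)
      where
      c≢v : c ≢ v
      c≢v refl with () ← trans (sym bc) (trans (adj-sym G b v) vb)
      vc : adj G v c ≡ true
      vc = Threshold-maxDegree-adj thr max b≢v c≢v bc
    b-isolated : Isolated G b
    b-isolated c with adj G b c in bc
    ... | false = refl
    ... | true with () ← trans (sym (v-adj-b bc)) vb

Threshold⇒Dominating⊎Isolated : ∀ {n} {G : Graph (suc n)} → Threshold G → ∃ (Dominating G) ⊎ ∃ (Isolated G)
Threshold⇒Dominating⊎Isolated {G = G} thr =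
  let v , max = maxDegree-vertex G in Sum.map₁ (v ,_) (maxDegree⇒Dominating⊎Isolated thr max)

degrees≤ : ∀ {n} (G : Graph (suc n)) → All (_≤ n) (degrees G)
degrees≤ {n} G = All.map⁺ (All.universal (degree≤ G) (allFin (suc n)))

same-order-length : ∀ {n} (G H : Graph n) {e d} → degrees G ↭ e → degrees H ↭ d → length d ≡ length e
same-order-length G H G⇒e H⇒d =
  trans (sym (↭-length H⇒d)) (trans (length-degrees H) (sym (trans (sym (↭-length G⇒e)) (length-degrees G))))

degrees-subst : ∀ {m n} (m≡n : m ≡ n) (H : Graph m) → degrees (subst Graph m≡n H) ≡ degrees H
degrees-subst refl H = refl

length-∷ʳ : ∀ {A : Set} (xs : List A) x → length (xs ∷ʳ x) ≡ suc (length xs)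
length-∷ʳ xs x = trans (length-++ xs) (+-comm (length xs) 1)

take-length-++ : ∀ {A : Set} (xs ys : List A) → take (length xs) (xs ++ ys) ≡ xs
take-length-++ []       ys = refl
take-length-++ (x ∷ xs) ys = cong (x ∷_) (take-length-++ xs ys)

Linked-∷ʳ⁻ : ∀ {A : Set} {R : A → A → Set} xs {z} → Linked R (xs ∷ʳ z) → Linked R xs
Linked-∷ʳ⁻ []           _         = []
Linked-∷ʳ⁻ (x ∷ [])     _         = [-]
Linked-∷ʳ⁻ (x ∷ y ∷ xs) (Rxy ∷ l) = Rxy ∷ Linked-∷ʳ⁻ (y ∷ xs) l

head-≥ : ∀ {x xs y} → Linked _≥_ (x ∷ xs) → y ∈ x ∷ xs → y ≤ x
head-≥ x∷xs↓ = All.lookup (Linked⇒All (λ x≥y y≥z → ≤-trans y≥z x≥y) ≤-refl x∷xs↓)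

last-≤ : ∀ xs {z y} → Linked _≥_ (xs ∷ʳ z) → y ∈ xs ∷ʳ z → z ≤ y
last-≤ []       _  (here refl) = ≤-refl
last-≤ (x ∷ xs) l  (here refl) = head-≥ l (∈-++⁺ʳ (x ∷ xs) (here refl))
last-≤ (x ∷ xs) l  (there y∈)  = last-≤ xs (Linked.tail l) y∈

All-positive⇒map-suc : ∀ {xs} → All (0 <_) xs → ∃ λ ys → xs ≡ map suc ys
All-positive⇒map-suc []                = [] , refl
All-positive⇒map-suc {suc x ∷ _} (_ ∷ ps) with All-positive⇒map-suc ps
... | ys , refl = x ∷ ys , refl

map-suc-↭⁻ : ∀ {xs ys} → map suc xs ↭ map suc ys → xs ↭ ys
map-suc-↭⁻ {xs} {ys} p = subst₂ _↭_ (pred∘suc xs) (pred∘suc ys) (↭-map⁺ pred p)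
  where
  pred∘suc : ∀ zs → map pred (map suc zs) ≡ zs
  pred∘suc zs = trans (sym (map-∘ zs)) (map-id zs)

Linked-map-suc⁻ : ∀ {xs} → Linked _≥_ (map suc xs) → Linked _≥_ xs
Linked-map-suc⁻ = Linked.map s≤s⁻¹ ∘ Linked-map⁻

↭-∷-map-suc : ∀ {n e X} → Linked _≥_ e → All (_≤ n) e → e ↭ n ∷ map suc X →
              ∃ λ e′ → e ≡ n ∷ map suc e′ × Linked _≥_ e′ × X ↭ e′
↭-∷-map-suc {e = []}     _  _          e↭ = ⊥-elim (¬x∷xs↭[] (↭-sym e↭))
↭-∷-map-suc {e = x ∷ e₁} {X} e↓ (x≤n ∷ _) e↭
  with refl ← ≤-antisym x≤n (head-≥ e↓ (∈-resp-↭ (↭-sym e↭) (here refl)))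
  with e′ , refl ← All-positive⇒map-suc
                     (All-resp-↭ (↭-sym (drop-∷ e↭)) (All.map⁺ (All.universal (λ _ → s≤s z≤n) X)))
  = e′ , refl , Linked-map-suc⁻ (Linked.tail e↓) , map-suc-↭⁻ (↭-sym (drop-∷ e↭))

↭-∷ʳ-0 : ∀ {e X} → Linked _≥_ e → e ↭ 0 ∷ X → ∃ λ e′ → e ≡ e′ ∷ʳ 0 × Linked _≥_ e′ × X ↭ e′
↭-∷ʳ-0 {e} e↓ e↭ with initLast e
... | []       = ⊥-elim (¬x∷xs↭[] (↭-sym e↭))
... | e′ ∷ʳ′ z with refl ← n≤0⇒n≡0 (last-≤ e′ e↓ (∈-resp-↭ (↭-sym e↭) (here refl))) =
  e′ , refl , Linked-∷ʳ⁻ e′ e↓ , ↭-sym (drop-∷ (↭-trans (↭-sym (++-comm e′ [ 0 ])) e↭))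

Majorizes : List ℕ → List ℕ → Set
Majorizes d e = sum d ≡ sum e × (∀ k → sum (take k e) ≤ sum (take k d))

⪰⇒Majorizes : ∀ {d e} → length d ≡ length e → d ⪰ e → Majorizes d e
⪰⇒Majorizes {d} {e} len (Σd≡Σe , prefix) = Σd≡Σe , prefix′
  where
  prefix′ : ∀ k → sum (take k e) ≤ sum (take k d)
  prefix′ zero = z≤n
  prefix′ (suc k) with suc k ≤? length e
  ... | yes k<e = prefix (suc k) (s≤s z≤n) (subst (suc k ≤_) (sym (trans (cong (length e ⊓_) len) (⊓-idem _))) k<e)
  ... | no  k≮e = subst₂ _≤_ (cong sum (sym (take-all (suc k) e e≤k))) (cong sum (sym (take-all (suc k) d d≤k)))
                             (≤-reflexive (sym Σd≡Σe))
    where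
    e≤k : length e ≤ suc k
    e≤k = <⇒≤ (≰⇒> k≮e)
    d≤k : length d ≤ suc k
    d≤k = subst (_≤ suc k) (sym len) e≤k

sum-map-suc : ∀ xs → sum (map suc xs) ≡ length xs + sum xs
sum-map-suc []       = refl
sum-map-suc (x ∷ xs) = cong suc (trans (cong (x +_) (sum-map-suc xs)) (x∙yz≈y∙xz x (length xs) (sum xs)))

Majorizes-∷-map-suc⁻ : ∀ {n d e} → length d ≡ length e → Majorizes (n ∷ map suc d) (n ∷ map suc e) → Majorizes d e
Majorizes-∷-map-suc⁻ {n} {d} {e} len (Σ≡ , prefix) = Σd≡Σe , prefix′
  where
  sum-take-map-suc : ∀ xs k → sum (take k (map suc xs)) ≡ length (take k xs) + sum (take k xs)
  sum-take-map-suc xs k = trans (cong sum (take-map k xs)) (sum-map-suc (take k xs))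
  Σd≡Σe : sum d ≡ sum e
  Σd≡Σe = +-cancelˡ-≡ (length e) _ _ (begin
    length e + sum d       ≡⟨ cong (_+ sum d) (sym len) ⟩
    length d + sum d       ≡⟨ sym (sum-map-suc d) ⟩
    sum (map suc d)        ≡⟨ +-cancelˡ-≡ n _ _ Σ≡ ⟩
    sum (map suc e)        ≡⟨ sum-map-suc e ⟩
    length e + sum e       ∎)
    where open ≡-Reasoning
  prefix′ : ∀ k → sum (take k e) ≤ sum (take k d)
  prefix′ k = +-cancelˡ-≤ (length (take k e)) _ _ (+-cancelˡ-≤ n _ _ (begin
    n + (length (take k e) + sum (take k e))  ≡⟨ cong (n +_) (sym (sum-take-map-suc e k)) ⟩
    n + sum (take k (map suc e))              ≤⟨ prefix (suc k) ⟩
    n + sum (take k (map suc d))              ≡⟨ cong (n +_) (sum-take-map-suc d k) ⟩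
    n + (length (take k d) + sum (take k d))  ≡⟨ cong (λ l → n + (l + sum (take k d))) take-lengths ⟩
    n + (length (take k e) + sum (take k d))  ∎))
    where
    open ≤-Reasoning
    take-lengths : length (take k d) ≡ length (take k e)
    take-lengths = trans (length-take k d) (trans (cong (k ⊓_) len) (sym (length-take k e)))

sum-∷ʳ : ∀ xs x → sum (xs ∷ʳ x) ≡ sum xs + x
sum-∷ʳ xs x = trans (sum-++ xs [ x ]) (cong (sum xs +_) (+-identityʳ x))

sum-take-∷ʳ-0 : ∀ k xs → sum (take k (xs ∷ʳ 0)) ≡ sum (take k xs)
sum-take-∷ʳ-0 zero          xs       = refl
sum-take-∷ʳ-0 (suc zero)    []       = refl
sum-take-∷ʳ-0 (suc (suc k)) []       = refl
sum-take-∷ʳ-0 (suc k)       (x ∷ xs) = cong (x +_) (sum-take-∷ʳ-0 k xs)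

Majorizes-∷ʳ-0⁻ : ∀ {d e} → Majorizes (d ∷ʳ 0) (e ∷ʳ 0) → Majorizes d e
Majorizes-∷ʳ-0⁻ {d} {e} (Σ≡ , prefix) =
  +-cancelʳ-≡ 0 (sum d) (sum e) (trans (sym (sum-∷ʳ d 0)) (trans Σ≡ (sum-∷ʳ e 0))) ,
  λ k → subst₂ _≤_ (sum-take-∷ʳ-0 k e) (sum-take-∷ʳ-0 k d) (prefix k)

Majorizes-∷ʳ-last : ∀ {d e w z} → length d ≡ length e → Majorizes (d ∷ʳ w) (e ∷ʳ z) → w ≤ z
Majorizes-∷ʳ-last {d} {e} {w} {z} len (Σ≡ , prefix) = +-cancelˡ-≤ (sum d) w z (begin
  sum d + w    ≡⟨ sym (sum-∷ʳ d w) ⟩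
  sum (d ∷ʳ w) ≡⟨ Σ≡ ⟩
  sum (e ∷ʳ z) ≡⟨ sum-∷ʳ e z ⟩
  sum e + z    ≤⟨ +-monoˡ-≤ z Σe≤Σd ⟩
  sum d + z    ∎)
  where
  open ≤-Reasoning
  Σe≤Σd : sum e ≤ sum d
  Σe≤Σd = subst₂ _≤_ (cong sum (take-length-++ e [ z ]))
                     (cong sum (trans (cong (λ l → take l (d ∷ʳ w)) (sym len)) (take-length-++ d [ w ])))
                     (prefix (length e))

Majorizes-∷-∈ : ∀ {n e} d → length d ≡ length (n ∷ e) → All (_≤ n) d → Majorizes d (n ∷ e) → n ∈ d
Majorizes-∷-∈ {n} (y ∷ d) _ (y≤n ∷ _) (_ , prefix) =
  here (≤-antisym (subst₂ _≤_ (+-identityʳ n) (+-identityʳ y) (prefix 1)) y≤n)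

Majorizes-∷ʳ-0-∈ : ∀ {e} d → length d ≡ length (e ∷ʳ 0) → Majorizes d (e ∷ʳ 0) → 0 ∈ d
Majorizes-∷ʳ-0-∈ {e} d len maj with initLast d
... | []        = contradiction (trans len (length-∷ʳ e 0)) λ ()
... | d₀ ∷ʳ′ w  = ∈-++⁺ʳ d₀ (here (sym (n≤0⇒n≡0 (Majorizes-∷ʳ-last d₀≡e maj))))
  where
  d₀≡e : length d₀ ≡ length e
  d₀≡e = suc-injective (trans (sym (length-∷ʳ d₀ w)) (trans len (length-∷ʳ e 0)))

MajorizationMaximal : ∀ {n} → Graph n → Set
MajorizationMaximal {n} G = ∀ (H : Graph n) {e d} → degrees G ↭ e → degrees H ↭ d →
  Linked _≥_ e → Linked _≥_ d → Majorizes d e → d ≡ e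

Dominating⇒MajorizationMaximal : ∀ {n} {G : Graph (suc n)} {v} → Dominating G v →
                                 MajorizationMaximal (G ─ v) → MajorizationMaximal G
Dominating⇒MajorizationMaximal {n} {G} {v} v-dom maximal H {e} {d} G⇒e H⇒d e↓ d↓ maj
  with e′ , refl , e′↓ , X↭e′ ← ↭-∷-map-suc e↓ (All-resp-↭ G⇒e (degrees≤ G))
                                   (↭-trans (↭-sym G⇒e) (degrees-delete-Dominating G v v-dom))
  with u , u-deg ← ∈-degrees⁻ H (∈-resp-↭ (↭-sym H⇒d)
                     (Majorizes-∷-∈ d (same-order-length G H G⇒e H⇒d) (All-resp-↭ H⇒d (degrees≤ H)) maj))
  with d′ , refl , d′↓ , Y↭d′ ← ↭-∷-map-suc d↓ (All-resp-↭ H⇒d (degrees≤ H))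
                                   (↭-trans (↭-sym H⇒d) (degrees-delete-Dominating H u (degree≡n⇒Dominating H u u-deg)))
  = cong (λ xs → n ∷ map suc xs)
      (maximal (H ─ u) X↭e′ Y↭d′ e′↓ d′↓
        (Majorizes-∷-map-suc⁻ (same-order-length (G ─ v) (H ─ u) X↭e′ Y↭d′) maj))

Isolated⇒MajorizationMaximal : ∀ {n} {G : Graph (suc n)} {v} → Isolated G v →
                               MajorizationMaximal (G ─ v) → MajorizationMaximal G
Isolated⇒MajorizationMaximal {n} {G} {v} v-iso maximal H {e} {d} G⇒e H⇒d e↓ d↓ maj
  with e′ , refl , e′↓ , X↭e′ ← ↭-∷ʳ-0 e↓ (↭-trans (↭-sym G⇒e) (degrees-delete-Isolated G v v-iso))
  with u , u-deg ← ∈-degrees⁻ H (∈-resp-↭ (↭-sym H⇒d) (Majorizes-∷ʳ-0-∈ d (same-order-length G H G⇒e H⇒d) maj))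
  with d′ , refl , d′↓ , Y↭d′ ← ↭-∷ʳ-0 d↓
                                   (↭-trans (↭-sym H⇒d) (degrees-delete-Isolated H u (degree≡0⇒Isolated H u u-deg)))
  = cong (_∷ʳ 0) (maximal (H ─ u) X↭e′ Y↭d′ e′↓ d′↓ (Majorizes-∷ʳ-0⁻ maj))

Threshold⇒MajorizationMaximal : ∀ {n} {G : Graph n} → Threshold G → MajorizationMaximal G
Threshold⇒MajorizationMaximal {zero} G-thr H G⇒e H⇒d _ _ _ =
  trans (↭-empty-inv (↭-sym H⇒d)) (sym (↭-empty-inv (↭-sym G⇒e)))
Threshold⇒MajorizationMaximal {suc n} {G} G-thr =
  Sum.[ (λ (v , v-dom) → Dominating⇒MajorizationMaximal {G = G} v-dom (maximal-─ v)) ,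
        (λ (v , v-iso) → Isolated⇒MajorizationMaximal {G = G} v-iso (maximal-─ v)) ]′
    (Threshold⇒Dominating⊎Isolated G-thr)
  where
  maximal-─ : ∀ v → MajorizationMaximal (G ─ v)
  maximal-─ v = Threshold⇒MajorizationMaximal (Threshold-≼ᵢ {H = G ─ v} (─-≼ᵢ G v) G-thr)

sum-take-< : ∀ {k xs} → All (0 <_) xs → k < length xs → sum (take k xs) < sum xs
sum-take-< {zero}  {x ∷ xs} (x>0 ∷ _) _         = ≤-trans x>0 (m≤m+n x (sum xs))
sum-take-< {suc k} {x ∷ xs} (_ ∷ xs⁺) (s≤s k<n) = +-monoʳ-< x (sum-take-< xs⁺ k<n)

⪰-prefix-length : ∀ {d} e → length e ≤ length d → d ⪰ e → sum e ≤ sum (take (length e) d)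
⪰-prefix-length []          _   _            = z≤n
⪰-prefix-length {d} e@(_ ∷ _) e≤d (_ , prefix) =
  subst (_≤ sum (take (length e) d)) (cong sum (take-all (length e) e ≤-refl))
        (prefix (length e) (s≤s z≤n) (≤-reflexive (sym (m≤n⇒m⊓n≡m e≤d))))

⪰-length-≤ : ∀ {d e} → All (0 <_) d → d ⪰ e → length d ≤ length e
⪰-length-≤ {d} {e} d⁺ d⪰e with length d ≤? length e
... | yes d≤e = d≤e
... | no  d≰e = ⊥-elim (<-irrefl (sym (proj₁ d⪰e)) (begin-strict
  sum e                        ≤⟨ ⪰-prefix-length e (<⇒≤ e<d) d⪰e ⟩
  sum (take (length e) d)      <⟨ sum-take-< d⁺ e<d ⟩
  sum d                        ∎))
  where
  open ≤-Reasoning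
  e<d : length e < length d
  e<d = ≰⇒> d≰e

Dominating-⪰-length : ∀ {n m} {G : Graph (suc n)} {v} → Dominating G v → (H : Graph (suc m)) → ∀ {e d} →
                      degrees G ↭ e → degrees H ↭ d → Linked _≥_ e → d ⪰ e → n ≤ m
Dominating-⪰-length _ _ {[]}        G⇒e _   _ _ = ⊥-elim (¬x∷xs↭[] G⇒e)
Dominating-⪰-length _ _ {_} {[]}    _   H⇒d _ _ = ⊥-elim (¬x∷xs↭[] H⇒d)
Dominating-⪰-length {n} {m} {G} {v} v-dom H {x ∷ e} {y ∷ d} G⇒e H⇒d e↓ (_ , prefix) = begin
  n  ≤⟨ head-≥ e↓ (∈-resp-↭ G⇒e (∈-resp-↭ (↭-sym (degrees-delete-Dominating G v v-dom)) (here refl))) ⟩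
  x  ≤⟨ subst₂ _≤_ (+-identityʳ x) (+-identityʳ y) (prefix 1 (s≤s z≤n) (s≤s z≤n)) ⟩
  y  ≤⟨ All.head (All-resp-↭ H⇒d (degrees≤ H)) ⟩
  m  ∎
  where open ≤-Reasoning

Threshold-⪰-length-≥ : ∀ {d e} {G : Graph (length e)} (H : Graph (length d)) → Threshold G →
                       degrees G ↭ e → degrees H ↭ d → Linked _≥_ e → All (0 <_) e → d ⪰ e → length e ≤ length d
Threshold-⪰-length-≥ {e = []}    _ _ _ _ _ _         _        = z≤n
Threshold-⪰-length-≥ {[]} {x ∷ e} _ _ _ _ _ (x>0 ∷ _) (Σ≡ , _) = ⊥-elim (<-irrefl Σ≡ (≤-trans x>0 (m≤m+n x (sum e))))
Threshold-⪰-length-≥ {y ∷ d} {x ∷ e} {G} H G-thr G⇒e H⇒d e↓ e⁺ d⪰e =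
  Sum.[ (λ (v , v-dom) → s≤s (Dominating-⪰-length {G = G} v-dom H G⇒e H⇒d e↓ d⪰e)) ,
        (λ (v , v-iso) → contradiction (All.lookup e⁺ (∈-resp-↭ G⇒e (degree-0∈ v v-iso))) λ ()) ]′
    (Threshold⇒Dominating⊎Isolated G-thr)
  where
  degree-0∈ : ∀ v → Isolated G v → 0 ∈ degrees G
  degree-0∈ v v-iso = ∈-resp-↭ (↭-sym (degrees-delete-Isolated G v v-iso)) (here refl)

Free⇒Threshold : ∀ {ℱ n} {G : Graph n} → ContainsInducedSubOf ℱ twoK2 → ContainsInducedSubOf ℱ C4 →
                 ContainsInducedSubOf ℱ P4 → Free ℱ G → Threshold G
Free⇒Threshold {G = G} 2K₂∈ℱ C₄∈ℱ P₄∈ℱ G-free = threshold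
  (Free⇒¬≼ᵢ {F = twoK2} {G} 2K₂∈ℱ G-free)
  (Free⇒¬≼ᵢ {F = C4} {G} C₄∈ℱ G-free)
  (Free⇒¬≼ᵢ {F = P4} {G} P₄∈ℱ G-free)

proposition3p4 : (ℱ : Family) →
    ContainsInducedSubOf ℱ twoK2 → ContainsInducedSubOf ℱ C4 → ContainsInducedSubOf ℱ P4 →
    DominanceMonotone ℱ
proposition3p4 ℱ 2K₂∈ℱ C₄∈ℱ P₄∈ℱ d e (d↓ , d⁺ , H , H⇒d) (e↓ , e⁺ , G , G⇒e) d⪰e e-forcibly =
  subst (ForciblyFree ℱ) (sym d≡e) e-forcibly
  where
  G-thr : Threshold G
  G-thr = Free⇒Threshold 2K₂∈ℱ C₄∈ℱ P₄∈ℱ (e-forcibly G G⇒e)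
  same-length : length d ≡ length e
  same-length = ≤-antisym (⪰-length-≤ d⁺ d⪰e) (Threshold-⪰-length-≥ H G-thr G⇒e H⇒d e↓ e⁺ d⪰e)
  d≡e : d ≡ e
  d≡e = Threshold⇒MajorizationMaximal G-thr (subst Graph same-length H) G⇒e
          (↭-trans (↭-reflexive (degrees-subst same-length H)) H⇒d) e↓ d↓ (⪰⇒Majorizes same-length d⪰e)
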